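{- Let $\phi:\{0,1\}^n\to\{0,1\}^n$ be a mapping from $\mathrm{Dictator}$ to $\mathrm{XOR}$, and suppose that the graph distance between $a_1$ and $b_j$ in the dependency graph $D_\phi$ is at least $d$. Then for every $y\in\{0,1\}^n$, $\mathrm{dist}(\phi^{ -1}(y),\phi^{ -1}(y+e_j))\ge \frac{d+1}{2}$.
   Context: $\mathrm{dist}$ is Hamming distance; $e_j$ is the $j$th standard basis vector and addition is mod 2. $\mathrm{Dictator}(x)=x_1$, $\mathrm{XOR}(x)=\sum_i x_i\bmod 2$. A mapping from $\mathrm{Dictator}$ to $\mathrm{XOR}$ is a bijection $\phi=(\phi_1,\dots,\phi_n)$ of $\{0,1\}^n$ with $\mathrm{Dictator}(x)=\mathrm{XOR}(\phi(x))$ for all $x$. Output bit $\phi_j$ depends on input bit $i$ if there is $x$ with $\phi_j(x)\ne\phi_j(x+e_i)$. The dependency graph $D_\phi$ is the bipartite graph on vertex classes $\{a_1,\dots,a_n\}$ and $\{b_1,\dots,b_n\}$ with an edge $a_ib_j$ iff $\phi_j$ depends on input bit $i$ (distance is $\infty$ if no path exists). -}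

module Defs where

open import Data.Bool using (Bool; true; false; _xor_; not; if_then_else_)
open import Data.Nat using (ℕ; zero; suc)
open import Data.Fin using (Fin)
open import Data.Vec using (Vec; []; _∷_; lookup; foldr; zipWith; countᵇ; _[_]%=_)
open import Data.Sum using (_⊎_; inj₁; inj₂)
open import Data.Product using (∃)
open import Data.Empty using (⊥)
open import Function.Bundles using (_↔_; Inverse)
open import Relation.Binary.PropositionalEquality using (_≡_; _≢_)

-- Points of the Boolean cube {0,1}^n  (false = 0, true = 1).
Bits : ℕ → Set
Bits n = Vec Bool n

_+e_ : ∀ {n} → Bits n → Fin n → Bits n
x +e j = x [ j ]%= not

dist : ∀ {n} → Bits n → Bits n → ℕ
dist x y = countᵇ (λ b → b) (zipWith _xor_ x y)

-- Dictator(x) = x_1  (first coordinate; needs n ≥ 1, so dimension is suc m)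
Dictator : ∀ {m} → Bits (suc m) → Bool
Dictator (x ∷ _) = x

XOR : ∀ {n} → Bits n → Bool
XOR = foldr _ _xor_ false

IsMappingDictatorXOR : ∀ {m} → (Bits (suc m) ↔ Bits (suc m)) → Set
IsMappingDictatorXOR φ = ∀ x → Dictator x ≡ XOR (Inverse.to φ x)

DependsOn : ∀ {n} → (Bits n → Bits n) → Fin n → Fin n → Set
DependsOn f j i = ∃ λ x → lookup (f x) j ≢ lookup (f (x +e i)) j

-- Vertices of the dependency graph: inj₁ i = a_i, inj₂ j = b_j
Vertex : ℕ → Set
Vertex n = Fin n ⊎ Fin n

Adj : ∀ {n} → (Bits n → Bits n) → Vertex n → Vertex n → Set
Adj f (inj₁ i) (inj₂ j) = DependsOn f j i
Adj f (inj₂ j) (inj₁ i) = DependsOn f j i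
Adj f (inj₁ _) (inj₁ _) = ⊥
Adj f (inj₂ _) (inj₂ _) = ⊥

data Walk {n} (f : Bits n → Bits n) : Vertex n → Vertex n → ℕ → Set where
  nil  : ∀ {u} → Walk f u u 0
  cons : ∀ {u w v k} → Adj f u w → Walk f w v k → Walk f u v (suc k)

-- Graph distance between u and v is at least d (distance = ∞ if no path):
-- every walk from u to v has at least d edges.
DistAtLeast : ∀ {n} → (Bits n → Bits n) → Vertex n → Vertex n → ℕ → Set
DistAtLeast f u v d = ∀ k → Walk f u v k → d Data.Nat.≤ k

-- Write x = φ⁻¹(y) and x' = φ⁻¹(y + e_j), and let S be the set of coordinates where they differ;
-- S contains 1, because φ turns the first input bit into the parity of the output.  Let B_t be
-- the set of inputs within distance 2t of a_1.  The sets S ∩ B_t grow with t and start nonempty,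
-- so S ∩ B_t = S ∩ B_(t+1) for some t < |S|.  Flipping x on C = S ∩ B_t changes no output bit
-- other than b_j: an output depending on a coordinate of C depends on no coordinate of S ∖ C
-- (those would lie in S ∩ B_(t+1) = C), so it cannot tell the flipped point from x', and φ(x')
-- agrees with φ(x) off b_j.  As φ is injective and C ≠ ∅, b_j must depend on a coordinate of C,
-- giving a walk of length ≤ 2t + 1 < 2|S| from a_1 to b_j.
module Submission where

open import Defs
open import Data.Nat using (ℕ; suc; _*_; _≤_)
open import Data.Fin using (Fin; zero)
open import Data.Sum using (inj₁; inj₂)
open import Function.Bundles using (_↔_; Inverse)

open import Data.Bool using (Bool; true; false; not; _xor_)
open import Data.Bool.Properties
  using (¬-not; not-¬; not-distribˡ-xor; not-distribʳ-xor; xor-comm; true-xor; xor-identityʳ)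
  renaming (_≟_ to _≟ᵇ_)
open import Data.Fin using (suc)
open import Data.Fin.Properties using (any?)
open import Data.Fin.Subset using (Subset; _∈_; _∉_; _⊆_; _∩_; _∪_; ⁅_⁆; ∣_∣)
open import Data.Fin.Subset.Properties
  using (_∈?_; x∈⁅x⁆; x∈⁅y⁆⇒x≡y; ∣⁅x⁆∣≡1; p⊆q⇒∣p∣≤∣q∣; p⊂q⇒∣p∣<∣q∣; p⊆p∪q; x∈p∪q⁺; x∈p∪q⁻;
         x∈p∩q⁺; x∈p∩q⁻; p∩q⊆p)
open import Data.Nat using (zero; _+_; _<_; z≤n; s≤s)
open import Data.Nat.Properties
  using (≤-refl; ≤-trans; m≤n⇒m≤1+n; n≤1+n; *-suc; *-monoʳ-≤; 1+n≰n; module ≤-Reasoning)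
open import Data.Product using (∃; ∃-syntax; _×_; _,_; proj₂)
open import Data.Sum using (_⊎_)
open import Data.Vec using ([]; _∷_; lookup; tabulate; zipWith)
open import Data.Vec.Properties
  using (lookup-zipWith; lookup∘tabulate; tabulate∘lookup; tabulate-cong; lookup∘updateAt′; []=⇒lookup; lookup⇒[]=)
open import Function using (_∘_)
open import Function.Bundles using (Injection)
open import Function.Properties.Inverse using (↔⇒↣)
open import Relation.Nullary using (¬_; Dec; yes; no; does; ¬?; contradiction)
open import Relation.Nullary.Decidable using (_×-dec_; _⊎-dec_; map′; dec-true)
open import Relation.Unary using (Pred; Decidable)
open import Relation.Binary.PropositionalEquality

private
  variable
    n : ℕ

lookup-ext : {u v : Bits n} → (∀ i → lookup u i ≡ lookup v i) → u ≡ v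
lookup-ext {u = u} {v} u≗v = trans (sym (tabulate∘lookup u)) (trans (tabulate-cong u≗v) (tabulate∘lookup v))

∈-tabulate⁺ : ∀ {ℓ} {P : Pred (Fin n) ℓ} (P? : Decidable P) {i : Fin n} → P i → i ∈ tabulate (does ∘ P?)
∈-tabulate⁺ P? {i} p = lookup⇒[]= i _ (trans (lookup∘tabulate (does ∘ P?) i) (dec-true (P? i) p))

∈-tabulate⁻ : ∀ {ℓ} {P : Pred (Fin n) ℓ} (P? : Decidable P) {i : Fin n} → i ∈ tabulate (does ∘ P?) → P i
∈-tabulate⁻ P? {i} i∈ with P? i in eq
... | yes p = p
... | no _ = contradiction (trans (sym (trans (lookup∘tabulate (does ∘ P?) i) (cong does eq))) ([]=⇒lookup i∈)) λ ()

∈⇒0<∣p∣ : {p : Subset n} {x : Fin n} → x ∈ p → 0 < ∣ p ∣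
∈⇒0<∣p∣ {p = p} {x} x∈p = subst (_≤ ∣ p ∣) (∣⁅x⁆∣≡1 x) (p⊆q⇒∣p∣≤∣q∣ ⁅x⁆⊆p)
  where
  ⁅x⁆⊆p : ⁅ x ⁆ ⊆ p
  ⁅x⁆⊆p y∈ = subst (_∈ p) (sym (x∈⁅y⁆⇒x≡y x y∈)) x∈p

-- Points of the cube as subsets: x ⊕ y is the set where x and y differ, and x ⊕ p flips x on p.

infixl 6 _⊕_
_⊕_ : Bits n → Bits n → Bits n
_⊕_ = zipWith _xor_

dist≡∣⊕∣ : (x y : Bits n) → dist x y ≡ ∣ x ⊕ y ∣
dist≡∣⊕∣ [] [] = refl
dist≡∣⊕∣ (a ∷ x) (b ∷ y) with a xor b
... | true = cong suc (dist≡∣⊕∣ x y)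
... | false = dist≡∣⊕∣ x y

module _ {x y : Bits n} {i : Fin n} where

  ∈-⊕⁺ : lookup x i ≢ lookup y i → i ∈ x ⊕ y
  ∈-⊕⁺ x≢y = lookup⇒[]= i _ (trans (lookup-zipWith _xor_ i x y) (differ (lookup x i) (lookup y i) x≢y))
    where
    differ : ∀ a b → a ≢ b → a xor b ≡ true
    differ true true a≢b = contradiction refl a≢b
    differ true false _ = refl
    differ false true _ = refl
    differ false false a≢b = contradiction refl a≢b

  ∈-⊕⁻ : i ∈ x ⊕ y → lookup y i ≡ not (lookup x i)
  ∈-⊕⁻ i∈ = differ (lookup x i) (lookup y i) (trans (sym (lookup-zipWith _xor_ i x y)) ([]=⇒lookup i∈))
    where
    differ : ∀ a b → a xor b ≡ true → b ≡ not a
    differ true false _ = refl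
    differ false true _ = refl

  lookup-⊕-∈ : i ∈ y → lookup (x ⊕ y) i ≡ not (lookup x i)
  lookup-⊕-∈ i∈y = begin
    lookup (x ⊕ y) i          ≡⟨ lookup-zipWith _xor_ i x y ⟩
    lookup x i xor lookup y i ≡⟨ cong (lookup x i xor_) ([]=⇒lookup i∈y) ⟩
    lookup x i xor true       ≡⟨ xor-comm (lookup x i) true ⟩
    true xor lookup x i       ≡⟨ true-xor (lookup x i) ⟩
    not (lookup x i)          ∎
    where open ≡-Reasoning

  lookup-⊕-∉ : i ∉ y → lookup (x ⊕ y) i ≡ lookup x i
  lookup-⊕-∉ i∉y = begin
    lookup (x ⊕ y) i          ≡⟨ lookup-zipWith _xor_ i x y ⟩
    lookup x i xor lookup y i ≡⟨ cong (lookup x i xor_) (¬-not (i∉y ∘ lookup⇒[]= i y)) ⟩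
    lookup x i xor false      ≡⟨ xor-identityʳ (lookup x i) ⟩
    lookup x i                ∎
    where open ≡-Reasoning

  ⊕-fixed⇒∉ : x ⊕ y ≡ x → i ∉ y
  ⊕-fixed⇒∉ fixed i∈y = not-¬ refl (trans (sym (cong (λ z → lookup z i) fixed)) (lookup-⊕-∈ i∈y))

XOR-+e : (y : Bits n) (j : Fin n) → XOR (y +e j) ≡ not (XOR y)
XOR-+e (a ∷ y) zero = sym (not-distribˡ-xor a (XOR y))
XOR-+e (a ∷ y) (suc j) = trans (cong (a xor_) (XOR-+e y j)) (sym (not-distribʳ-xor a (XOR y)))

∃-Bits? : ∀ n {ℓ} {P : Pred (Bits n) ℓ} → Decidable P → Dec (∃ P)
∃-Bits? zero P? = map′ ([] ,_) (λ { ([] , p) → p }) (P? [])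
∃-Bits? (suc n) {P = P} P? = map′ extend restrict (∃-Bits? n (P? ∘ (true ∷_)) ⊎-dec ∃-Bits? n (P? ∘ (false ∷_)))
  where
  extend : ∃ (P ∘ (true ∷_)) ⊎ ∃ (P ∘ (false ∷_)) → ∃ P
  extend (inj₁ (x , p)) = true ∷ x , p
  extend (inj₂ (x , p)) = false ∷ x , p
  restrict : ∃ P → ∃ (P ∘ (true ∷_)) ⊎ ∃ (P ∘ (false ∷_))
  restrict (true ∷ x , p) = inj₁ (x , p)
  restrict (false ∷ x , p) = inj₂ (x , p)

DependsOn? : (f : Bits n → Bits n) (k i : Fin n) → Dec (DependsOn f k i)
DependsOn? {n} f k i = ∃-Bits? n λ x → ¬? (lookup (f x) k ≟ᵇ lookup (f (x +e i)) k)

agree-if-insensitive : (g : Bits n → Bool) {u v : Bits n} →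
  (∀ i → lookup u i ≢ lookup v i → ∀ w → g w ≡ g (w +e i)) → g u ≡ g v
agree-if-insensitive g {[]} {[]} _ = refl
agree-if-insensitive g {a ∷ u} {b ∷ v} insensitive =
  trans head (agree-if-insensitive (g ∘ (b ∷_)) λ i ne w → insensitive (suc i) ne (b ∷ w))
  where
  head : g (a ∷ u) ≡ g (b ∷ u)
  head with a ≟ᵇ b
  ... | yes refl = refl
  ... | no a≢b = trans (insensitive zero a≢b (a ∷ u)) (cong (g ∘ (_∷ u)) (sym (¬-not (a≢b ∘ sym))))

agree-if-independent : (f : Bits n → Bits n) (k : Fin n) {u v : Bits n} →
  (∀ i → lookup u i ≢ lookup v i → ¬ DependsOn f k i) → lookup (f u) k ≡ lookup (f v) k
agree-if-independent f k independent = agree-if-insensitive (λ w → lookup (f w) k) insensitive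
  where
  insensitive : ∀ i → _ → ∀ w → lookup (f w) k ≡ lookup (f (w +e i)) k
  insensitive i ne w with lookup (f w) k ≟ᵇ lookup (f (w +e i)) k
  ... | yes eq = eq
  ... | no neq = contradiction (w , neq) (independent i ne)

module _ (f : Bits n → Bits n) {x x' C : Bits n} (j : Fin n)
  (agree-off-j : ∀ k → k ≢ j → lookup (f x) k ≡ lookup (f x') k)
  (C⊆S : C ⊆ x ⊕ x')
  (j-free : ∀ {i} → i ∈ C → ¬ DependsOn f j i)
  (closed : ∀ {k i i'} → i ∈ C → DependsOn f k i → DependsOn f k i' → i' ∈ x ⊕ x' → i' ∈ C)
  where

  private
    z : Bits n
    z = x ⊕ C

    differs-from-x : ∀ {i} → lookup z i ≢ lookup x i → i ∈ C
    differs-from-x {i} ne with i ∈? C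
    ... | yes i∈C = i∈C
    ... | no i∉C = contradiction (lookup-⊕-∉ {x = x} i∉C) ne

    differs-from-x' : ∀ {i} → lookup z i ≢ lookup x' i → i ∈ x ⊕ x' × i ∉ C
    differs-from-x' {i} ne with i ∈? C
    ... | yes i∈C = contradiction (trans (lookup-⊕-∈ {x = x} i∈C) (sym (∈-⊕⁻ (C⊆S i∈C)))) ne
    ... | no i∉C = ∈-⊕⁺ (ne ∘ trans (lookup-⊕-∉ {x = x} i∉C)) , i∉C

  flip-closed-invisible : f (x ⊕ C) ≡ f x
  flip-closed-invisible = lookup-ext output
    where
    output : ∀ k → lookup (f z) k ≡ lookup (f x) k
    output k with any? (λ i → (i ∈? C) ×-dec DependsOn? f k i)
    ... | yes (i , i∈C , k∼i) = begin
      lookup (f z) k  ≡⟨ agree-if-independent f k (λ i' ne k∼i' →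
                           let i'∈S , i'∉C = differs-from-x' ne in i'∉C (closed i∈C k∼i k∼i' i'∈S)) ⟩
      lookup (f x') k ≡⟨ sym (agree-off-j k λ { refl → j-free i∈C k∼i }) ⟩
      lookup (f x) k  ∎
      where open ≡-Reasoning
    ... | no untouched = agree-if-independent f k λ i ne k∼i → untouched (i , differs-from-x ne , k∼i)

infixl 5 _▷_
_▷_ : {f : Bits n → Bits n} {u v w : Vertex n} {k : ℕ} → Walk f u v k → Adj f v w → Walk f u w (suc k)
nil ▷ e = cons e nil
cons e walk ▷ e' = cons e (walk ▷ e')

module Balls (f : Bits n → Bits n) (s : Fin n) where

  Linked : Fin n → Fin n → Set
  Linked i i' = ∃[ k ] DependsOn f k i × DependsOn f k i'

  LinkedTo? : (p : Subset n) (i' : Fin n) → Dec (∃[ i ] i ∈ p × Linked i i')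
  LinkedTo? p i' = any? λ i → (i ∈? p) ×-dec any? λ k → DependsOn? f k i ×-dec DependsOn? f k i'

  spread : Subset n → Subset n
  spread p = tabulate (does ∘ LinkedTo? p)

  _▷²_ : ∀ {u i i' l} → Walk f u (inj₁ i) l → Linked i i' → Walk f u (inj₁ i') (2 + l)
  walk ▷² (k , k∼i , k∼i') = _▷_ {w = inj₂ k} walk k∼i ▷ k∼i'

  -- ball t is the set of inputs within distance 2t of a_s in the dependency graph of f.
  ball : ℕ → Subset n
  ball zero = ⁅ s ⁆
  ball (suc t) = ball t ∪ spread (ball t)

  ball-⊆-suc : ∀ t → ball t ⊆ ball (suc t)
  ball-⊆-suc t = p⊆p∪q (spread (ball t))

  linked⇒∈ball-suc : ∀ {t i i'} → i ∈ ball t → Linked i i' → i' ∈ ball (suc t)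
  linked⇒∈ball-suc i∈ linked = x∈p∪q⁺ (inj₂ (∈-tabulate⁺ (LinkedTo? _) (_ , i∈ , linked)))

  centre∈ball : ∀ t → s ∈ ball t
  centre∈ball zero = x∈⁅x⁆ s
  centre∈ball (suc t) = ball-⊆-suc t (centre∈ball t)

  ∈ball⇒walk : ∀ t {i} → i ∈ ball t → ∃[ l ] l ≤ 2 * t × Walk f (inj₁ s) (inj₁ i) l
  ∈ball⇒walk zero i∈ rewrite x∈⁅y⁆⇒x≡y s i∈ = 0 , z≤n , nil
  ∈ball⇒walk (suc t) i∈ with x∈p∪q⁻ (ball t) (spread (ball t)) i∈
  ... | inj₁ i∈ball with ∈ball⇒walk t i∈ball
  ...   | l , l≤2t , walk = l , ≤-trans l≤2t (*-monoʳ-≤ 2 (n≤1+n t)) , walk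
  ∈ball⇒walk (suc t) i∈ | inj₂ i∈spread with ∈-tabulate⁻ (LinkedTo? (ball t)) i∈spread
  ...   | i₀ , i₀∈ball , linked with ∈ball⇒walk t i₀∈ball
  ...     | l , l≤2t , walk =
    suc (suc l) , subst (suc (suc l) ≤_) (sym (*-suc 2 t)) (s≤s (s≤s l≤2t)) , walk ▷² linked

module _ (L : ℕ → Subset n) (increasing : ∀ t → L t ⊆ L (suc t)) {x : Fin n} (x∈L₀ : x ∈ L 0) where

  stalls-or-grows : ∀ N → (∃[ t ] t < N × L (suc t) ⊆ L t) ⊎ (N < ∣ L N ∣)
  stalls-or-grows zero = inj₂ (∈⇒0<∣p∣ x∈L₀)
  stalls-or-grows (suc N) with stalls-or-grows N
  ... | inj₁ (t , t<N , stall) = inj₁ (t , m≤n⇒m≤1+n t<N , stall)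
  ... | inj₂ grown with any? (λ i → (i ∈? L (suc N)) ×-dec ¬? (i ∈? L N))
  ...   | yes (i , i∈ , i∉) = inj₂ (≤-trans (s≤s grown) (p⊂q⇒∣p∣<∣q∣ (increasing N , i , i∈ , i∉)))
  ...   | no ¬new = inj₁ (N , ≤-refl , stall)
    where
    stall : L (suc N) ⊆ L N
    stall {i} i∈ with i ∈? L N
    ... | yes i∈L = i∈L
    ... | no i∉L = contradiction (i , i∈ , i∉L) ¬new

  chain-stalls : (q : Subset n) → (∀ t → L t ⊆ q) → ∃[ t ] t < ∣ q ∣ × L (suc t) ⊆ L t
  chain-stalls q bounded with stalls-or-grows ∣ q ∣
  ... | inj₁ stall = stall
  ... | inj₂ grown = contradiction (≤-trans grown (p⊆q⇒∣p∣≤∣q∣ (bounded ∣ q ∣))) 1+n≰n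

module _ {m} (φ : Bits (suc m) ↔ Bits (suc m)) (isMapping : IsMappingDictatorXOR φ)
  (j : Fin (suc m)) (y : Bits (suc m)) where

  open Inverse φ using (to; from; strictlyInverseˡ)
  open Balls to zero

  private
    x x' S : Bits (suc m)
    x = from y
    x' = from (y +e j)
    S = x ⊕ x'

    C : ℕ → Subset (suc m)
    C t = S ∩ ball t

    lookup-to-from : ∀ v k → lookup (to (from v)) k ≡ lookup v k
    lookup-to-from v k = cong (λ w → lookup w k) (strictlyInverseˡ v)

  outputs-agree-off-j : ∀ k → k ≢ j → lookup (to x) k ≡ lookup (to x') k
  outputs-agree-off-j k k≢j = begin
    lookup (to x) k   ≡⟨ lookup-to-from y k ⟩
    lookup y k        ≡⟨ sym (lookup∘updateAt′ k j k≢j y) ⟩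
    lookup (y +e j) k ≡⟨ sym (lookup-to-from (y +e j) k) ⟩
    lookup (to x') k  ∎
    where open ≡-Reasoning

  first-bit-differs : zero ∈ S
  first-bit-differs = ∈-⊕⁺ λ eq → not-¬ refl (trans eq x'₀≡not-x₀)
    where
    Dictator≡lookup : (v : Bits (suc m)) → Dictator v ≡ lookup v zero
    Dictator≡lookup (a ∷ v) = refl
    x'₀≡not-x₀ : lookup x' zero ≡ not (lookup x zero)
    x'₀≡not-x₀ = begin
      lookup x' zero        ≡⟨ sym (Dictator≡lookup x') ⟩
      Dictator x'           ≡⟨ isMapping x' ⟩
      XOR (to x')           ≡⟨ cong XOR (strictlyInverseˡ (y +e j)) ⟩
      XOR (y +e j)          ≡⟨ XOR-+e y j ⟩
      not (XOR y)           ≡⟨ cong not (cong XOR (sym (strictlyInverseˡ y))) ⟩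
      not (XOR (to x))      ≡⟨ cong not (sym (isMapping x)) ⟩
      not (Dictator x)      ≡⟨ cong not (Dictator≡lookup x) ⟩
      not (lookup x zero)   ∎
      where open ≡-Reasoning

  C-increasing : ∀ t → C t ⊆ C (suc t)
  C-increasing t i∈ = let i∈S , i∈B = x∈p∩q⁻ S (ball t) i∈ in x∈p∩q⁺ (i∈S , ball-⊆-suc t i∈B)

  closed-if-stalled : ∀ {t} → C (suc t) ⊆ C t →
    ∀ {k i i'} → i ∈ C t → DependsOn to k i → DependsOn to k i' → i' ∈ S → i' ∈ C t
  closed-if-stalled {t} stall i∈C k∼i k∼i' i'∈S =
    stall (x∈p∩q⁺ (i'∈S , linked⇒∈ball-suc {t = t} (proj₂ (x∈p∩q⁻ S (ball t) i∈C)) (_ , k∼i , k∼i')))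

  j-depends-on-ball : ∃[ t ] t < ∣ S ∣ × ∃[ i ] i ∈ ball t × DependsOn to j i
  j-depends-on-ball
    with chain-stalls C C-increasing (x∈p∩q⁺ (first-bit-differs , centre∈ball 0)) S (λ t → p∩q⊆p S (ball t))
  ... | t , t<∣S∣ , stall with any? (λ i → (i ∈? C t) ×-dec DependsOn? to j i)
  ...   | yes (i , i∈C , j∼i) = t , t<∣S∣ , i , proj₂ (x∈p∩q⁻ S (ball t) i∈C) , j∼i
  ...   | no j-free = contradiction (x∈p∩q⁺ (first-bit-differs , centre∈ball t)) (⊕-fixed⇒∉ x⊕C≡x)
    where
    x⊕C≡x : x ⊕ C t ≡ x
    x⊕C≡x = Injection.injective (↔⇒↣ φ)
      (flip-closed-invisible to j outputs-agree-off-j (p∩q⊆p S (ball t))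
        (λ i∈C j∼i → j-free (_ , i∈C , j∼i)) (closed-if-stalled {t} stall))

lemma2p1 : ∀ {m} (φ : Bits (suc m) ↔ Bits (suc m)) → IsMappingDictatorXOR φ →
    ∀ (j : Fin (suc m)) (d : ℕ) →
    DistAtLeast (Inverse.to φ) (inj₁ zero) (inj₂ j) d →
    ∀ (y : Bits (suc m)) →
    suc d ≤ 2 * dist (Inverse.from φ y) (Inverse.from φ (y +e j))
lemma2p1 φ isMapping j d far y with j-depends-on-ball φ isMapping j y
... | t , t<∣S∣ , i , i∈ball , j∼i with Balls.∈ball⇒walk (Inverse.to φ) zero t i∈ball
...   | l , l≤2t , walk = begin
  suc d                             ≤⟨ s≤s (far (suc l) (walk ▷ j∼i)) ⟩
  suc (suc l)                       ≤⟨ s≤s (s≤s l≤2t) ⟩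
  2 + 2 * t                         ≡⟨ *-suc 2 t ⟨
  2 * suc t                         ≤⟨ *-monoʳ-≤ 2 t<∣S∣ ⟩
  2 * ∣ from y ⊕ from (y +e j) ∣    ≡⟨ cong (2 *_) (dist≡∣⊕∣ (from y) (from (y +e j))) ⟨
  2 * dist (from y) (from (y +e j)) ∎
  where
  open Inverse φ using (from)
  open ≤-Reasoning
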